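{- Let $n\ge3$ and let $S_n=K_{1,n-1}$ be the star graph on $n$ vertices. Then $t(S_n)=t_e(S_n)+1=t(1,n-1)+1$.
   Context: For a finite simple graph $G$, a family of subsets $B_v\subseteq[1,t]=\{1,\dots,t\}$, one for each vertex $v$, is a $G$-ECFF$(t,|V(G)|)$ if for every edge $\{a,b\}$ and every vertex $w\notin\{a,b\}$, $B_w\not\subseteq B_a\cup B_b$; it is a $G$-CFF$(t,|V(G)|)$ if in addition $B_a\not\subseteq B_b$ and $B_b\not\subseteq B_a$ for every edge $\{a,b\}$. $t_e(G)$ and $t(G)$ denote the minimum $t$ for which a $G$-ECFF, respectively a $G$-CFF, on $|V(G)|$ sets exists. $t(1,m)$ is the minimum $t$ such that there exist $m$ subsets of $[1,t]$ none contained in another; equivalently $t(1,m)=\min\{t:\binom{t}{\lfloor t/2\rfloor}\ge m\}$. -}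

module Defs where

open import Data.Nat using (ℕ; _≤_)
open import Data.Fin using (Fin; toℕ)
open import Data.Fin.Subset using (Subset; _⊆_; _∪_)
open import Data.Product using (_×_; ∃)
open import Data.Sum using (_⊎_)
open import Relation.Nullary using (¬_)
open import Relation.Binary.PropositionalEquality using (_≡_; _≢_)

record Graph (n : ℕ) : Set₁ where
  field
    Adj   : Fin n → Fin n → Set
    sym   : ∀ {a b} → Adj a b → Adj b a
    irrefl : ∀ {a} → ¬ Adj a a
open Graph public

star : (n : ℕ) → Graph n
star n = record
  { Adj = λ a b → (toℕ a ≡ 0 × toℕ b ≢ 0) ⊎ (toℕ b ≡ 0 × toℕ a ≢ 0)
  ; sym = λ { (Data.Sum.inj₁ p) → Data.Sum.inj₂ p ; (Data.Sum.inj₂ p) → Data.Sum.inj₁ p }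
  ; irrefl = λ { (Data.Sum.inj₁ (p , q)) → q p ; (Data.Sum.inj₂ (p , q)) → q p }
  }
  where open Data.Product using (_,_)

IsECFF : ∀ {n} (G : Graph n) (t : ℕ) → (Fin n → Subset t) → Set
IsECFF G t B = ∀ a b → Adj G a b → ∀ w → w ≢ a → w ≢ b → ¬ (B w ⊆ (B a ∪ B b))

IsCFF : ∀ {n} (G : Graph n) (t : ℕ) → (Fin n → Subset t) → Set
IsCFF G t B = IsECFF G t B × (∀ a b → Adj G a b → ¬ (B a ⊆ B b) × ¬ (B b ⊆ B a))

IsAntichain : ∀ (m t : ℕ) → (Fin m → Subset t) → Set
IsAntichain m t B = ∀ i j → i ≢ j → ¬ (B i ⊆ B j)

IsMin : (ℕ → Set) → ℕ → Set
IsMin P t = P t × (∀ s → P s → t ≤ s)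

IsTe : ∀ {n} → Graph n → ℕ → Set
IsTe {n} G = IsMin (λ t → ∃ λ (B : Fin n → Subset t) → IsECFF G t B)

IsT : ∀ {n} → Graph n → ℕ → Set
IsT {n} G = IsMin (λ t → ∃ λ (B : Fin n → Subset t) → IsCFF G t B)

IsT1 : ℕ → ℕ → Set
IsT1 m = IsMin (λ t → ∃ λ (B : Fin m → Subset t) → IsAntichain m t B)

-- In a star every edge joins the centre c to a leaf, so the ECFF condition says exactly that no
-- leaf set lies in B c ∪ B j for another leaf j. With B c = ∅ this is an antichain of n − 1 sets,
-- and any ECFF yields such an antichain, so t_e(S_n) = t(1, n − 1). A CFF additionally needs
-- B c ⊈ B j, so the centre contains some point x; deleting x from every set leaves an
-- antichain on t − 1 points. Conversely, a fresh point for the centre turns an antichain into a CFF.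
module Submission where

open import Defs
open import Data.Nat using (ℕ; _≤_; _∸_; suc; zero; s≤s)
open import Data.Product using (_×_; _,_; ∃; ∃-syntax)
open import Data.Sum using (_⊎_; inj₁; inj₂)
open import Data.Fin using (Fin; punchIn; punchOut) renaming (zero to fz; suc to fs)
open import Data.Fin.Properties using (suc-injective; punchInᵢ≢i) renaming (_≟_ to _≟ᶠ_)
open import Data.Fin.Subset using (Subset; _⊆_; _∪_; _∈_; ⊥; inside; outside; Nonempty)
open import Data.Fin.Subset.Properties
  using (∉⊥; ⊆-min; ⊆-trans; ⊆-reflexive; q⊆p∪q; x∈p∪q⁺; ∪-comm; ∪-identityˡ; nonempty?; Empty-unique; drop-there; drop-∷-⊆)
open import Data.Vec using (_∷_; removeAt; here; there)
open import Data.Vec.Properties using (removeAt-punchOut; []=⇒lookup; lookup⇒[]=)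
open import Data.Empty using (⊥-elim)
open import Function using (_∘_)
open import Relation.Nullary using (¬_; yes; no; contradiction)
open import Relation.Binary.PropositionalEquality using (_≡_; _≢_; refl; cong; trans; ≢-sym) renaming (sym to ≡-sym)

private
  variable
    m t : ℕ

⊈⇒nonempty : {p q : Subset t} → ¬ (p ⊆ q) → Nonempty p
⊈⇒nonempty {p = p} {q} p⊈q with nonempty? p
... | yes ne = ne
... | no ¬ne = ⊥-elim (p⊈q (⊆-trans (⊆-reflexive (Empty-unique ¬ne)) (⊆-min q)))

antichain-nonempty : {A : Fin (suc (suc m)) → Subset t} →
  IsAntichain (suc (suc m)) t A → ∀ i → Nonempty (A i)
antichain-nonempty anti i = ⊈⇒nonempty (anti i (punchIn i fz) (≢-sym (punchInᵢ≢i i fz)))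

∈-removeAt⁺ : {p : Subset (suc t)} {x y : Fin (suc t)} (x≢y : x ≢ y) →
  y ∈ p → punchOut x≢y ∈ removeAt p x
∈-removeAt⁺ {p = p} x≢y y∈p = lookup⇒[]= _ _ (trans (removeAt-punchOut p x≢y) ([]=⇒lookup y∈p))

∈-removeAt⁻ : {p : Subset (suc t)} {x y : Fin (suc t)} (x≢y : x ≢ y) →
  punchOut x≢y ∈ removeAt p x → y ∈ p
∈-removeAt⁻ {p = p} x≢y y∈p = lookup⇒[]= _ _ (trans (≡-sym (removeAt-punchOut p x≢y)) ([]=⇒lookup y∈p))

removeAt-⊆⇒⊆-∪ : {p q r : Subset (suc t)} {x : Fin (suc t)} → x ∈ r →
  removeAt p x ⊆ removeAt q x → p ⊆ r ∪ q
removeAt-⊆⇒⊆-∪ {x = x} x∈r sub {y} y∈p with x ≟ᶠ y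
... | yes refl = x∈p∪q⁺ (inj₁ x∈r)
... | no x≢y = x∈p∪q⁺ (inj₂ (∈-removeAt⁻ x≢y (sub (∈-removeAt⁺ x≢y y∈p))))

leaves : (Fin (suc m) → Subset t) → Fin m → Subset t
leaves B = B ∘ fs

withCentre : Subset t → (Fin m → Subset t) → Fin (suc m) → Subset t
withCentre c A fz = c
withCentre c A (fs i) = A i

centre-adj : (j : Fin m) → Adj (star (suc m)) fz (fs j)
centre-adj j = inj₁ (refl , λ ())

star-edge : {a b : Fin (suc m)} → Adj (star (suc m)) a b →
  (∃[ j ] a ≡ fz × b ≡ fs j) ⊎ (∃[ j ] a ≡ fs j × b ≡ fz)
star-edge {a = fz} {fs j} _ = inj₁ (j , refl , refl)
star-edge {a = fs i} {fz} _ = inj₂ (i , refl , refl)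
star-edge {a = fz} {fz} (inj₁ (_ , 0≢0)) = contradiction refl 0≢0
star-edge {a = fz} {fz} (inj₂ (_ , 0≢0)) = contradiction refl 0≢0
star-edge {a = fs _} {fs _} (inj₁ (() , _))
star-edge {a = fs _} {fs _} (inj₂ (() , _))

LeavesSeparated : (Fin (suc m) → Subset t) → Set
LeavesSeparated {m} B = ∀ (i j : Fin m) → i ≢ j → ¬ (B (fs i) ⊆ B fz ∪ B (fs j))

star-ecff⇒separated : {B : Fin (suc m) → Subset t} → IsECFF (star (suc m)) t B → LeavesSeparated B
star-ecff⇒separated E i j i≢j = E fz (fs j) (centre-adj j) (fs i) (λ ()) (i≢j ∘ suc-injective)

separated⇒leaf-not-covered : {B : Fin (suc m) → Subset t} → LeavesSeparated B →
  ∀ j w → w ≢ fz → w ≢ fs j → ¬ (B w ⊆ B fz ∪ B (fs j))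
separated⇒leaf-not-covered sep j fz w≢c _ = contradiction refl w≢c
separated⇒leaf-not-covered sep j (fs i) _ w≢j = sep i j (w≢j ∘ cong fs)

separated⇒star-ecff : {B : Fin (suc m) → Subset t} → LeavesSeparated B → IsECFF (star (suc m)) t B
separated⇒star-ecff {B = B} sep a b ab w w≢a w≢b with star-edge ab
... | inj₁ (j , refl , refl) = separated⇒leaf-not-covered {B = B} sep j w w≢a w≢b
... | inj₂ (j , refl , refl) = λ w⊆ → separated⇒leaf-not-covered {B = B} sep j w w≢b w≢a
        (⊆-trans w⊆ (⊆-reflexive (∪-comm (B (fs j)) (B fz))))

star-ecff⇒leaf-antichain : {B : Fin (suc m) → Subset t} →
  IsECFF (star (suc m)) t B → IsAntichain m t (leaves B)
star-ecff⇒leaf-antichain {B = B} E i j i≢j i⊆j =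
  star-ecff⇒separated E i j i≢j (⊆-trans i⊆j (q⊆p∪q (B fz) (B (fs j))))

star-ecff⇒removeAt-antichain : {B : Fin (suc m) → Subset (suc t)} {x : Fin (suc t)} →
  IsECFF (star (suc m)) (suc t) B → x ∈ B fz →
  IsAntichain m t (λ i → removeAt (B (fs i)) x)
star-ecff⇒removeAt-antichain E x∈c i j i≢j sub =
  star-ecff⇒separated E i j i≢j (removeAt-⊆⇒⊆-∪ x∈c sub)

star-cff⇒centre-nonempty : {B : Fin (suc (suc m)) → Subset t} →
  IsCFF (star (suc (suc m))) t B → Nonempty (B fz)
star-cff⇒centre-nonempty {m = m} (_ , C) with C fz (fs fz) (centre-adj {suc m} fz)
... | c⊈l , _ = ⊈⇒nonempty c⊈l

antichain⇒separated : {A : Fin m → Subset t} → IsAntichain m t A → LeavesSeparated (withCentre ⊥ A)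
antichain⇒separated {A = A} anti i j i≢j i⊆⊥∪j =
  anti i j i≢j (⊆-trans i⊆⊥∪j (⊆-reflexive (∪-identityˡ (A j))))

antichain⇒star-ecff : {A : Fin m → Subset t} → IsAntichain m t A →
  IsECFF (star (suc m)) t (withCentre ⊥ A)
antichain⇒star-ecff anti = separated⇒star-ecff (antichain⇒separated anti)

star-cff-intro : {B : Fin (suc m) → Subset t} → IsECFF (star (suc m)) t B →
  (∀ j → ¬ (B fz ⊆ B (fs j))) → (∀ j → ¬ (B (fs j) ⊆ B fz)) → IsCFF (star (suc m)) t B
star-cff-intro {m = m} {B = B} E c⊈l l⊈c = E , edge-incomparable
  where
  edge-incomparable : ∀ a b → Adj (star (suc m)) a b → ¬ (B a ⊆ B b) × ¬ (B b ⊆ B a)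
  edge-incomparable a b ab with star-edge ab
  ... | inj₁ (j , refl , refl) = c⊈l j , l⊈c j
  ... | inj₂ (j , refl , refl) = l⊈c j , c⊈l j

freshCentre : (Fin m → Subset t) → Fin (suc m) → Subset (suc t)
freshCentre A = withCentre (inside ∷ ⊥) (λ i → outside ∷ A i)

antichain⇒star-cff : {A : Fin (suc (suc m)) → Subset t} → IsAntichain (suc (suc m)) t A →
  IsCFF (star (suc (suc (suc m)))) (suc t) (freshCentre A)
antichain⇒star-cff {A = A} anti =
  star-cff-intro (separated⇒star-ecff (λ i j i≢j → antichain⇒separated anti i j i≢j ∘ drop-∷-⊆))
    centre⊈leaf leaf⊈centre
  where
  centre⊈leaf : ∀ j → ¬ (inside ∷ ⊥ ⊆ outside ∷ A j)
  centre⊈leaf j sub with sub here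
  ... | ()
  leaf⊈centre : ∀ j → ¬ (outside ∷ A j ⊆ inside ∷ ⊥)
  leaf⊈centre j sub with antichain-nonempty anti j
  ... | y , y∈ = ∉⊥ (drop-there (sub (there y∈)))

corollary5p4 : (n : ℕ) → 3 ≤ n → (s : ℕ) → IsT1 (n ∸ 1) s →
    IsT (star n) (suc s) × IsTe (star n) s
corollary5p4 (suc zero) (s≤s ())
corollary5p4 (suc (suc zero)) (s≤s (s≤s ()))
corollary5p4 (suc (suc (suc m))) _ s ((A , anti) , minimal) =
  ((_ , antichain⇒star-cff anti) , cff-bound) , ((_ , antichain⇒star-ecff anti) , ecff-bound)
  where
  ecff-bound : ∀ t → ∃ (IsECFF (star (suc (suc (suc m)))) t) → s ≤ t
  ecff-bound t (B , E) = minimal t (_ , star-ecff⇒leaf-antichain E)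

  cff-bound : ∀ t → ∃ (IsCFF (star (suc (suc (suc m)))) t) → suc s ≤ t
  cff-bound t (B , C) with star-cff⇒centre-nonempty C
  cff-bound (suc t) (B , E , _) | x , x∈c = s≤s (minimal t (_ , star-ecff⇒removeAt-antichain E x∈c))
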